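{- Let $p,q$ be integers, $n\ge 0$ an integer, and $x$ a number with $x\neq 1$ and $1+3x+x^2\neq 0$. Then $$\begin{aligned}\sum_{k=0}^n x^kG_{p+k}H_{q-k}=&\frac{1}{1+3x+x^2}\big[x^{n+1}(xG_{p+n}H_{q-n}-G_{p+n+1}H_{q-n-1})+G_pH_q-xG_{p-1}H_{q+1}\big]\\&-\frac{x(x^{n+1}-1)}{(1-x)(1+3x+x^2)}\big(2G_pH_q+G_{p-1}H_{q-1}+G_{p+1}H_{q+1}\big).\end{aligned}$$
   Context: $(G_n)_{n\in\mathbb Z}$ and $(H_n)_{n\in\mathbb Z}$ are generalized Fibonacci sequences: $G_{n+2}=G_{n+1}+G_n$ and $H_{n+2}=H_{n+1}+H_n$ for all integers $n$, with arbitrary initial values $G_0,G_1$ and $H_0,H_1$. -}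

module Defs where

open import Level using (_⊔_)
open import Algebra.Bundles using (CommutativeRing)
open import Data.Nat using (ℕ; zero; suc)
open import Data.Integer as ℤ using (ℤ; +_)

module _ {c ℓ} (R : CommutativeRing c ℓ) where
  open CommutativeRing R hiding (zero)

  minus : Carrier → Carrier → Carrier
  minus a b = a + (- b)

  pow : Carrier → ℕ → Carrier
  pow x zero = 1#
  pow x (suc k) = x * pow x k

  sumTo : ℕ → (ℕ → Carrier) → Carrier
  sumTo zero f = f zero
  sumTo (suc n) f = sumTo n f + f (suc n)

  IsGenFib : (ℤ → Carrier) → Set ℓ
  IsGenFib G = ∀ (n : ℤ) → G (n ℤ.+ + 2) ≈ G (n ℤ.+ + 1) + G n

-- The products u k = G (p + k) · H (q - k) satisfy u (k+2) + 3 u (k+1) + u k = C for a constant C: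
-- the characteristic roots of k ↦ G (p + k) and k ↦ H (q - k) are φ, ψ and -ψ, -φ, whose products
-- are 1, -φ² and -ψ², and -φ², -ψ² are the roots of t² + 3t + 1. Hence multiplying Σ xᵏ u k by
-- 1 + 3x + x² telescopes to boundary terms plus C · (x + ⋯ + xⁿ⁺¹), and (1 - x) times that
-- geometric sum is x - xⁿ⁺².
{-# OPTIONS --safe #-}
module Submission where

open import Algebra.Bundles using (CommutativeRing)
open import Relation.Binary.Bundles using (Setoid)
open import Data.Nat as ℕ using (ℕ; zero; suc)
open import Data.Integer as ℤ using (ℤ; +_; -[1+_]; 0ℤ; 1ℤ; -1ℤ)
import Data.Integer.Properties as ℤ
open import Data.Maybe using (Maybe; just; nothing)
open import Relation.Binary.PropositionalEquality as ≡ using (_≡_)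
open import Relation.Nullary using (yes; no)
open import Algebra.Solver.Ring.AlmostCommutativeRing
  using (fromCommutativeRing; _-Raw-AlmostCommutative⟶_)
open import Data.Integer.Tactic.RingSolver using (solve-∀)
open import Defs

module IntegerCoefficientSolver {c ℓ} (R : CommutativeRing c ℓ) where
  open CommutativeRing R
  open import Algebra.Properties.Ring ring using (-0#≈0#; -‿involutive; -‿+-comm; -‿distribˡ-*; -‿distribʳ-*)
  open import Algebra.Properties.CommutativeSemigroup +-commutativeSemigroup using (interchange)
  -- This _×_ has 1 × 1# = 1# definitionally, so the solver's constant 1 evaluates to the literal 1#.
  open import Algebra.Properties.Semiring.Mult.TCOptimised semiring using (_×_; 1+×; ×-homo-+; ×1-homo-*)
  open import Relation.Binary.Reasoning.Setoid setoid

  fromℤ : ℤ → Carrier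
  fromℤ (+ n)    = n × 1#
  fromℤ -[1+ n ] = - (suc n × 1#)

  fromℤ-cong : ∀ {i j} → i ≡ j → fromℤ i ≈ fromℤ j
  fromℤ-cong i≡j = reflexive (≡.cong fromℤ i≡j)

  fromℤ-homo-neg : ∀ i → fromℤ (ℤ.- i) ≈ - fromℤ i
  fromℤ-homo-neg (+ zero)   = sym -0#≈0#
  fromℤ-homo-neg (+ suc n)  = refl
  fromℤ-homo-neg -[1+ n ]   = sym (-‿involutive _)

  fromℤ-homo-⊖ : ∀ m n → fromℤ (m ℤ.⊖ n) ≈ m × 1# - n × 1#
  fromℤ-homo-⊖ zero    zero    = sym (-‿inverseʳ 0#)
  fromℤ-homo-⊖ zero    (suc n) = sym (+-identityˡ _)
  fromℤ-homo-⊖ (suc m) zero    = sym (trans (+-congˡ -0#≈0#) (+-identityʳ _))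
  fromℤ-homo-⊖ (suc m) (suc n) = begin
    fromℤ (suc m ℤ.⊖ suc n)               ≈⟨ fromℤ-cong (ℤ.[1+m]⊖[1+n]≡m⊖n m n) ⟩
    fromℤ (m ℤ.⊖ n)                       ≈⟨ fromℤ-homo-⊖ m n ⟩
    m × 1# - n × 1#                       ≈⟨ +-identityˡ _ ⟨
    0# + (m × 1# - n × 1#)                ≈⟨ +-congʳ (-‿inverseʳ 1#) ⟨
    (1# - 1#) + (m × 1# - n × 1#)         ≈⟨ interchange 1# (- 1#) (m × 1#) (- (n × 1#)) ⟩
    (1# + m × 1#) + (- 1# - n × 1#)       ≈⟨ +-congˡ (-‿+-comm 1# (n × 1#)) ⟩
    (1# + m × 1#) - (1# + n × 1#)         ≈⟨ +-cong (1+× m 1#) (-‿cong (1+× n 1#)) ⟨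
    suc m × 1# - suc n × 1#               ∎

  fromℤ-homo-+ : ∀ i j → fromℤ (i ℤ.+ j) ≈ fromℤ i + fromℤ j
  fromℤ-homo-+ (+ m)    (+ n)    = ×-homo-+ 1# m n
  fromℤ-homo-+ (+ m)    -[1+ n ] = fromℤ-homo-⊖ m (suc n)
  fromℤ-homo-+ -[1+ m ] (+ n)    = trans (fromℤ-homo-⊖ n (suc m)) (+-comm _ _)
  fromℤ-homo-+ -[1+ m ] -[1+ n ] = begin
    fromℤ (ℤ.- + suc m ℤ.+ ℤ.- + suc n)      ≈⟨ fromℤ-cong (ℤ.neg-distrib-+ (+ suc m) (+ suc n)) ⟨
    fromℤ (ℤ.- (+ suc m ℤ.+ + suc n))        ≈⟨ fromℤ-homo-neg (+ suc m ℤ.+ + suc n) ⟩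
    - ((suc m ℕ.+ suc n) × 1#)               ≈⟨ -‿cong (×-homo-+ 1# (suc m) (suc n)) ⟩
    - (suc m × 1# + suc n × 1#)              ≈⟨ -‿+-comm _ _ ⟨
    - (suc m × 1#) + - (suc n × 1#)          ∎

  fromℤ-homo-*-pos : ∀ m j → fromℤ (+ m ℤ.* j) ≈ m × 1# * fromℤ j
  fromℤ-homo-*-pos m (+ n)    = trans (fromℤ-cong (≡.sym (ℤ.pos-* m n))) (×1-homo-* m n)
  fromℤ-homo-*-pos m -[1+ n ] = begin
    fromℤ (+ m ℤ.* ℤ.- + suc n)              ≈⟨ fromℤ-cong (ℤ.neg-distribʳ-* (+ m) (+ suc n)) ⟨
    fromℤ (ℤ.- (+ m ℤ.* + suc n))            ≈⟨ fromℤ-homo-neg (+ m ℤ.* + suc n) ⟩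
    - fromℤ (+ m ℤ.* + suc n)                ≈⟨ -‿cong (fromℤ-homo-*-pos m (+ suc n)) ⟩
    - (m × 1# * suc n × 1#)                  ≈⟨ -‿distribʳ-* _ _ ⟩
    m × 1# * - (suc n × 1#)                  ∎

  fromℤ-homo-* : ∀ i j → fromℤ (i ℤ.* j) ≈ fromℤ i * fromℤ j
  fromℤ-homo-* (+ m)    j = fromℤ-homo-*-pos m j
  fromℤ-homo-* -[1+ m ] j = begin
    fromℤ (ℤ.- + suc m ℤ.* j)                ≈⟨ fromℤ-cong (ℤ.neg-distribˡ-* (+ suc m) j) ⟨
    fromℤ (ℤ.- (+ suc m ℤ.* j))              ≈⟨ fromℤ-homo-neg (+ suc m ℤ.* j) ⟩
    - fromℤ (+ suc m ℤ.* j)                  ≈⟨ -‿cong (fromℤ-homo-*-pos (suc m) j) ⟩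
    - (suc m × 1# * fromℤ j)                 ≈⟨ -‿distribˡ-* _ _ ⟩
    - (suc m × 1#) * fromℤ j                 ∎

  fromℤ-morphism : ℤ.+-*-rawRing -Raw-AlmostCommutative⟶ fromCommutativeRing R
  fromℤ-morphism = record
    { ⟦_⟧    = fromℤ
    ; +-homo = fromℤ-homo-+
    ; *-homo = fromℤ-homo-*
    ; -‿homo = fromℤ-homo-neg
    ; 0-homo = refl
    ; 1-homo = refl
    }

  fromℤ-≟ : ∀ i j → Maybe (fromℤ i ≈ fromℤ j)
  fromℤ-≟ i j with i ℤ.≟ j
  ... | yes i≡j = just (fromℤ-cong i≡j)
  ... | no  _   = nothing

  open import Algebra.Solver.Ring ℤ.+-*-rawRing (fromCommutativeRing R) fromℤ-morphism fromℤ-≟ public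


module _ {a ℓ} (S : Setoid a ℓ) where
  open Setoid S

  suc-invariant⇒constant : (f : ℤ → Carrier) → (∀ k → f (ℤ.suc k) ≈ f k) → ∀ i j → f i ≈ f j
  suc-invariant⇒constant f f-suc i j = trans (≈-0ℤ i) (sym (≈-0ℤ j))
    where
    ≈-0ℤ : ∀ k → f k ≈ f 0ℤ
    ≈-0ℤ (+ zero)         = refl
    ≈-0ℤ (+ suc n)        = trans (f-suc (+ n)) (≈-0ℤ (+ n))
    ≈-0ℤ -[1+ zero ]      = sym (f-suc -1ℤ)
    ≈-0ℤ -[1+ suc n ]     = trans (sym (f-suc -[1+ suc n ])) (≈-0ℤ -[1+ n ])

private
  +-suc-suc : ∀ p k → p ℤ.+ (+ 1 ℤ.+ (+ 1 ℤ.+ k)) ≡ p ℤ.+ k ℤ.+ + 2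
  +-suc-suc = solve-∀

  +-suc : ∀ p k → p ℤ.+ (+ 1 ℤ.+ k) ≡ p ℤ.+ k ℤ.+ + 1
  +-suc = solve-∀

  -‿suc : ∀ q k → q ℤ.- (+ 1 ℤ.+ k) ≡ q ℤ.- k ℤ.- + 1
  -‿suc = solve-∀

  -‿suc-suc+2 : ∀ q k → q ℤ.- (+ 1 ℤ.+ (+ 1 ℤ.+ k)) ℤ.+ + 2 ≡ q ℤ.- k
  -‿suc-suc+2 = solve-∀

  -‿suc-suc+1 : ∀ q k → q ℤ.- (+ 1 ℤ.+ (+ 1 ℤ.+ k)) ℤ.+ + 1 ≡ q ℤ.- (+ 1 ℤ.+ k)
  -‿suc-suc+1 = solve-∀

module _ {c ℓ} (R : CommutativeRing c ℓ) where
  open CommutativeRing R hiding (zero)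
  open IntegerCoefficientSolver R using (solve; _:=_; _:+_; _:*_; _:-_; con; Polynomial)

  open import Relation.Binary.Reasoning.Setoid setoid

  :1 : ∀ {n} → Polynomial n
  :1 = con (+ 1)

  sumTo-cong : ∀ n {f g : ℕ → Carrier} → (∀ k → f k ≈ g k) → sumTo R n f ≈ sumTo R n g
  sumTo-cong zero    f≈g = f≈g zero
  sumTo-cong (suc n) f≈g = +-cong (sumTo-cong n f≈g) (f≈g (suc n))

  geometric-sum : ∀ x n → (1# - x) * sumTo R n (pow R x) ≈ 1# - pow R x (suc n)
  geometric-sum x zero    = solve 1 (λ x → (:1 :- x) :* :1 := :1 :- x :* :1) refl x
  geometric-sum x (suc n) = begin
    (1# - x) * (sumTo R n (pow R x) + pow R x (suc n))
      ≈⟨ distribˡ (1# - x) _ _ ⟩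
    (1# - x) * sumTo R n (pow R x) + (1# - x) * pow R x (suc n)
      ≈⟨ +-congʳ (geometric-sum x n) ⟩
    1# - x * y + (1# - x) * (x * y)
      ≈⟨ solve 2 (λ x y → :1 :- x :* y :+ (:1 :- x) :* (x :* y) := :1 :- x :* (x :* y)) refl x y ⟩
    1# - x * (x * y) ∎
    where
    y : Carrier
    y = pow R x n

  E²+3E+1 : (ℤ → Carrier) → ℤ → Carrier
  E²+3E+1 u k = u (ℤ.suc (ℤ.suc k)) + (u (ℤ.suc k) + u (ℤ.suc k) + u (ℤ.suc k)) + u k

  E²+3E+1-cong : ∀ {a a′ b b′ c c′} → a ≈ a′ → b ≈ b′ → c ≈ c′ →
                 a + (b + b + b) + c ≈ a′ + (b′ + b′ + b′) + c′
  E²+3E+1-cong a≈ b≈ c≈ = +-cong (+-cong a≈ (+-cong (+-cong b≈ b≈) b≈)) c≈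

  weightedSum-telescope : ∀ (x c : Carrier) (u : ℤ → Carrier) → (∀ k → E²+3E+1 u k ≈ c) →
    ∀ n → (1# + (x + x + x) + x * x) * sumTo R n (λ k → pow R x k * u (+ k))
        ≈ pow R x (suc n) * (x * u (+ n) - u (+ suc n)) + u 0ℤ - x * u -1ℤ
          + c * (x * sumTo R n (pow R x))
  weightedSum-telescope x c u u-rec zero = begin
    (1# + (x + x + x) + x * x) * (1# * u 0ℤ)
      ≈⟨ solve 4 (λ x u₋₁ u₀ u₁ →
             (:1 :+ (x :+ x :+ x) :+ x :* x) :* (:1 :* u₀)
           := x :* :1 :* (x :* u₀ :- u₁) :+ u₀ :- x :* u₋₁ :+ (u₁ :+ (u₀ :+ u₀ :+ u₀) :+ u₋₁) :* (x :* :1))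
           refl x (u -1ℤ) (u 0ℤ) (u 1ℤ) ⟩
    x * 1# * (x * u 0ℤ - u 1ℤ) + u 0ℤ - x * u -1ℤ + (u 1ℤ + (u 0ℤ + u 0ℤ + u 0ℤ) + u -1ℤ) * (x * 1#)
      ≈⟨ +-congˡ (*-congʳ (u-rec -1ℤ)) ⟩
    x * 1# * (x * u 0ℤ - u 1ℤ) + u 0ℤ - x * u -1ℤ + c * (x * 1#) ∎
  weightedSum-telescope x c u u-rec (suc n) = begin
    D * (S + x * y * u (+ suc n))
      ≈⟨ distribˡ D S _ ⟩
    D * S + D * (x * y * u (+ suc n))
      ≈⟨ +-congʳ (weightedSum-telescope x c u u-rec n) ⟩
    x * y * (x * u (+ n) - u (+ suc n)) + u 0ℤ - x * u -1ℤ + c * (x * g) + D * (x * y * u (+ suc n))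
      ≈⟨ solve 9 (λ x y g c u₋₁ u₀ uₙ uₙ₊₁ uₙ₊₂ →
             x :* y :* (x :* uₙ :- uₙ₊₁) :+ u₀ :- x :* u₋₁ :+ c :* (x :* g)
               :+ (:1 :+ (x :+ x :+ x) :+ x :* x) :* (x :* y :* uₙ₊₁)
           := x :* (x :* y) :* (x :* uₙ₊₁ :- uₙ₊₂) :+ u₀ :- x :* u₋₁ :+ c :* (x :* g)
               :+ x :* (x :* y) :* (uₙ₊₂ :+ (uₙ₊₁ :+ uₙ₊₁ :+ uₙ₊₁) :+ uₙ))
           refl x y g c (u -1ℤ) (u 0ℤ) (u (+ n)) (u (+ suc n)) (u (+ suc (suc n))) ⟩
    E + c * (x * g) + x * (x * y) * (u (+ suc (suc n)) + (u (+ suc n) + u (+ suc n) + u (+ suc n)) + u (+ n))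
      ≈⟨ +-congˡ (*-congˡ (u-rec (+ n))) ⟩
    E + c * (x * g) + x * (x * y) * c
      ≈⟨ solve 5 (λ x y g c E → E :+ c :* (x :* g) :+ x :* (x :* y) :* c := E :+ c :* (x :* (g :+ x :* y)))
           refl x y g c E ⟩
    E + c * (x * (g + x * y)) ∎
    where
    D S y g E : Carrier
    D = 1# + (x + x + x) + x * x
    S = sumTo R n (λ k → pow R x k * u (+ k))
    y = pow R x n
    g = sumTo R n (pow R x)
    E = x * (x * y) * (x * u (+ suc n) - u (+ suc (suc n))) + u 0ℤ - x * u -1ℤ

  IsGenFib⇒shifted : ∀ {G} → IsGenFib R G → ∀ p k →
                     G (p ℤ.+ ℤ.suc (ℤ.suc k)) ≈ G (p ℤ.+ ℤ.suc k) + G (p ℤ.+ k)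
  IsGenFib⇒shifted {G} G-fib p k = begin
    G (p ℤ.+ ℤ.suc (ℤ.suc k))     ≡⟨ ≡.cong G (+-suc-suc p k) ⟩
    G (p ℤ.+ k ℤ.+ + 2)           ≈⟨ G-fib (p ℤ.+ k) ⟩
    G (p ℤ.+ k ℤ.+ + 1) + G (p ℤ.+ k) ≡⟨ ≡.cong (λ i → G i + G (p ℤ.+ k)) (+-suc p k) ⟨
    G (p ℤ.+ ℤ.suc k) + G (p ℤ.+ k) ∎

  IsGenFib⇒reflected : ∀ {H} → IsGenFib R H → ∀ q k →
                       H (q ℤ.- k) ≈ H (q ℤ.- ℤ.suc k) + H (q ℤ.- ℤ.suc (ℤ.suc k))
  IsGenFib⇒reflected {H} H-fib q k = begin
    H (q ℤ.- k)                   ≡⟨ ≡.cong H (-‿suc-suc+2 q k) ⟨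
    H (q ℤ.- ℤ.suc (ℤ.suc k) ℤ.+ + 2) ≈⟨ H-fib (q ℤ.- ℤ.suc (ℤ.suc k)) ⟩
    H (q ℤ.- ℤ.suc (ℤ.suc k) ℤ.+ + 1) + H (q ℤ.- ℤ.suc (ℤ.suc k))
      ≡⟨ ≡.cong (λ i → H i + H (q ℤ.- ℤ.suc (ℤ.suc k))) (-‿suc-suc+1 q k) ⟩
    H (q ℤ.- ℤ.suc k) + H (q ℤ.- ℤ.suc (ℤ.suc k)) ∎

  fibonacciProduct-E²+3E+1 : (g h : ℤ → Carrier) →
    (∀ k → g (ℤ.suc (ℤ.suc k)) ≈ g (ℤ.suc k) + g k) →
    (∀ k → h k ≈ h (ℤ.suc k) + h (ℤ.suc (ℤ.suc k))) →
    ∀ k → E²+3E+1 (λ i → g i * h i) k ≈ (1# + 1#) * g 0ℤ * h 0ℤ + g -1ℤ * h 1ℤ + g 1ℤ * h -1ℤ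
  fibonacciProduct-E²+3E+1 g h g-rec h-rec k =
    trans (suc-invariant⇒constant setoid w w-suc k -1ℤ) w-at-−1
    where
    w : ℤ → Carrier
    w = E²+3E+1 (λ i → g i * h i)

    -- everything is rewritten in terms of g k, g (k+1), h (k+2) and h (k+3)
    w-suc : ∀ k → w (ℤ.suc k) ≈ w k
    w-suc k = begin
      g₃ * h₃ + (g₂ * h₂ + g₂ * h₂ + g₂ * h₂) + g₁ * h₁
        ≈⟨ E²+3E+1-cong (*-congʳ g₃≈) (*-congʳ (g-rec k)) (*-congˡ (h-rec k₁)) ⟩
      (g₁ + g₀ + g₁) * h₃ + ((g₁ + g₀) * h₂ + (g₁ + g₀) * h₂ + (g₁ + g₀) * h₂) + g₁ * (h₂ + h₃)
        ≈⟨ solve 4 (λ g₀ g₁ h₂ h₃ →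
               (g₁ :+ g₀ :+ g₁) :* h₃ :+ ((g₁ :+ g₀) :* h₂ :+ (g₁ :+ g₀) :* h₂ :+ (g₁ :+ g₀) :* h₂)
                 :+ g₁ :* (h₂ :+ h₃)
             := (g₁ :+ g₀) :* h₂ :+ (g₁ :* (h₂ :+ h₃) :+ g₁ :* (h₂ :+ h₃) :+ g₁ :* (h₂ :+ h₃))
                 :+ g₀ :* (h₂ :+ h₃ :+ h₂))
             refl g₀ g₁ h₂ h₃ ⟩
      (g₁ + g₀) * h₂ + (g₁ * (h₂ + h₃) + g₁ * (h₂ + h₃) + g₁ * (h₂ + h₃)) + g₀ * (h₂ + h₃ + h₂)
        ≈⟨ E²+3E+1-cong (*-congʳ (g-rec k)) (*-congˡ (h-rec k₁)) (*-congˡ h₀≈) ⟨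
      g₂ * h₂ + (g₁ * h₁ + g₁ * h₁ + g₁ * h₁) + g₀ * h₀ ∎
      where
      k₁ : ℤ
      k₁ = ℤ.suc k
      g₀ g₁ g₂ g₃ h₀ h₁ h₂ h₃ : Carrier
      g₀ = g k
      g₁ = g k₁
      g₂ = g (ℤ.suc k₁)
      g₃ = g (ℤ.suc (ℤ.suc k₁))
      h₀ = h k
      h₁ = h k₁
      h₂ = h (ℤ.suc k₁)
      h₃ = h (ℤ.suc (ℤ.suc k₁))
      g₃≈ : g₃ ≈ g₁ + g₀ + g₁
      g₃≈ = trans (g-rec k₁) (+-congʳ (g-rec k))
      h₀≈ : h₀ ≈ h₂ + h₃ + h₂
      h₀≈ = trans (h-rec k) (+-congʳ (h-rec k₁))

    w-at-−1 : w -1ℤ ≈ (1# + 1#) * g 0ℤ * h 0ℤ + g -1ℤ * h 1ℤ + g 1ℤ * h -1ℤ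
    w-at-−1 = begin
      g 1ℤ * h 1ℤ + (g 0ℤ * h 0ℤ + g 0ℤ * h 0ℤ + g 0ℤ * h 0ℤ) + g -1ℤ * h -1ℤ
        ≈⟨ E²+3E+1-cong (*-congʳ (g-rec -1ℤ)) refl (*-congˡ (h-rec -1ℤ)) ⟩
      (g 0ℤ + g -1ℤ) * h 1ℤ + (g 0ℤ * h 0ℤ + g 0ℤ * h 0ℤ + g 0ℤ * h 0ℤ) + g -1ℤ * (h 0ℤ + h 1ℤ)
        ≈⟨ solve 4 (λ g₋₁ g₀ h₀ h₁ →
               (g₀ :+ g₋₁) :* h₁ :+ (g₀ :* h₀ :+ g₀ :* h₀ :+ g₀ :* h₀) :+ g₋₁ :* (h₀ :+ h₁)
             := (:1 :+ :1) :* g₀ :* h₀ :+ g₋₁ :* h₁ :+ (g₀ :+ g₋₁) :* (h₀ :+ h₁))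
             refl (g -1ℤ) (g 0ℤ) (h 0ℤ) (h 1ℤ) ⟩
      (1# + 1#) * g 0ℤ * h 0ℤ + g -1ℤ * h 1ℤ + (g 0ℤ + g -1ℤ) * (h 0ℤ + h 1ℤ)
        ≈⟨ +-congˡ (*-cong (g-rec -1ℤ) (h-rec -1ℤ)) ⟨
      (1# + 1#) * g 0ℤ * h 0ℤ + g -1ℤ * h 1ℤ + g 1ℤ * h -1ℤ ∎

  clear-denominators : ∀ {x a b D S E c s y} → a * (1# - x) ≈ 1# → b * D ≈ 1# →
    D * S ≈ E + c * (x * s) → (1# - x) * s ≈ 1# - y →
    S ≈ b * E - x * (y - 1#) * (a * b) * c
  clear-denominators {x} {a} {b} {D} {S} {E} {c} {s} {y} a-inv b-inv DS≈ s≈ = begin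
    S                                  ≈⟨ *-identityˡ S ⟨
    1# * S                             ≈⟨ *-congʳ b-inv ⟨
    b * D * S                          ≈⟨ *-assoc b D S ⟩
    b * (D * S)                        ≈⟨ *-congˡ DS≈ ⟩
    b * (E + c * (x * s))              ≈⟨ *-congˡ (+-congˡ (*-congˡ (*-congˡ s≈a[1-y]))) ⟩
    b * (E + c * (x * (a * (1# - y)))) ≈⟨ solve 6 (λ x a b E c y →
                                            b :* (E :+ c :* (x :* (a :* (:1 :- y))))
                                          := b :* E :- x :* (y :- :1) :* (a :* b) :* c)
                                          refl x a b E c y ⟩
    b * E - x * (y - 1#) * (a * b) * c ∎
    where
    s≈a[1-y] : s ≈ a * (1# - y)
    s≈a[1-y] = begin
      s                  ≈⟨ *-identityˡ s ⟨
      1# * s             ≈⟨ *-congʳ a-inv ⟨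
      a * (1# - x) * s   ≈⟨ *-assoc a _ s ⟩
      a * ((1# - x) * s) ≈⟨ *-congˡ s≈ ⟩
      a * (1# - y)       ∎

mainTheorem6 : ∀ {c ℓ} (R : CommutativeRing c ℓ) →
    let open CommutativeRing R hiding (zero) in
    (G H : ℤ → Carrier) → IsGenFib R G → IsGenFib R H →
    (p q : ℤ) (n : ℕ) (x : Carrier) →
    -- x ≠ 1, expressed as: 1 - x is invertible with inverse a
    (a : Carrier) → a * minus R 1# x ≈ 1# →
    -- 1 + 3x + x² ≠ 0, expressed as: it is invertible with inverse b
    (b : Carrier) → b * (1# + (x + x + x) + x * x) ≈ 1# →
    sumTo R n (λ k → pow R x k * G (p ℤ.+ + k) * H (q ℤ.- + k))
      ≈ minus R
          (b * (minus R
                  (pow R x (suc n) * minus R (x * G (p ℤ.+ + n) * H (q ℤ.- + n))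
                                             (G (p ℤ.+ + n ℤ.+ + 1) * H (q ℤ.- + n ℤ.- + 1))
                   + G p * H q)
                  (x * G (p ℤ.- + 1) * H (q ℤ.+ + 1))))
          (x * minus R (pow R x (suc n)) 1# * (a * b)
             * ((1# + 1#) * G p * H q
                + G (p ℤ.- + 1) * H (q ℤ.- + 1)
                + G (p ℤ.+ + 1) * H (q ℤ.+ + 1)))
mainTheorem6 R G H G-fib H-fib p q n x a a-inv b b-inv = begin
  sumTo R n (λ k → pow R x k * G (p ℤ.+ + k) * H (q ℤ.- + k))
    ≈⟨ sumTo-cong R n (λ k → *-assoc _ _ _) ⟩
  sumTo R n (λ k → pow R x k * u (+ k))
    ≈⟨ clear-denominators R a-inv b-inv (weightedSum-telescope R x C u u-rec n) (geometric-sum R x n) ⟩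
  b * (pow R x (suc n) * (x * u (+ n) - u (+ suc n)) + u 0ℤ - x * u -1ℤ)
    - x * (pow R x (suc n) - 1#) * (a * b) * C
    ≈⟨ +-congʳ (*-congˡ (+-cong (+-cong (*-congˡ (+-cong (sym (*-assoc x _ _)) (-‿cong uₙ₊₁≈))) u₀≈)
                                (-‿cong (sym (*-assoc x _ _))))) ⟩
  b * (pow R x (suc n) * (x * G (p ℤ.+ + n) * H (q ℤ.- + n) - G (p ℤ.+ + n ℤ.+ + 1) * H (q ℤ.- + n ℤ.- + 1))
       + G p * H q - x * G (p ℤ.- + 1) * H (q ℤ.+ + 1))
    - x * (pow R x (suc n) - 1#) * (a * b) * C ∎
  where
  open CommutativeRing R hiding (zero)
  open import Relation.Binary.Reasoning.Setoid setoid

  u : ℤ → Carrier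
  u k = G (p ℤ.+ k) * H (q ℤ.- k)

  C : Carrier
  C = (1# + 1#) * G p * H q + G (p ℤ.- + 1) * H (q ℤ.- + 1) + G (p ℤ.+ + 1) * H (q ℤ.+ + 1)

  u₀≈ : u 0ℤ ≈ G p * H q
  u₀≈ = *-cong (reflexive (≡.cong G (ℤ.+-identityʳ p))) (reflexive (≡.cong H (ℤ.+-identityʳ q)))

  uₙ₊₁≈ : u (+ suc n) ≈ G (p ℤ.+ + n ℤ.+ + 1) * H (q ℤ.- + n ℤ.- + 1)
  uₙ₊₁≈ = *-cong (reflexive (≡.cong G (+-suc p (+ n)))) (reflexive (≡.cong H (-‿suc q (+ n))))

  u-rec : ∀ k → E²+3E+1 R u k ≈ C
  u-rec k = trans (fibonacciProduct-E²+3E+1 R _ _ (IsGenFib⇒shifted R G-fib p) (IsGenFib⇒reflected R H-fib q) k)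
                  (+-congʳ (+-congʳ (trans (*-assoc _ _ _) (trans (*-congˡ u₀≈) (sym (*-assoc _ _ _))))))
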